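{- Let $(N_1,m_1)\vartriangleright_E(N_2,m_2)$ and let $G$ be a well-formed TFG for this equivalence. For a marking $m_2'$ of $N_2$ let $\mathrm{Inv}(m_2')=\{c_{|N_1} : c \text{ is a total, well-defined configuration of } G \text{ with } c\equiv m_2'\}$. Then the family $\{\mathrm{Inv}(m_2') : m_2'\in R(N_2,m_2)\}$ is a partition of $R(N_1,m_1)$.
   Context: A Petri net $N=(P,T,\mathrm{Pre},\mathrm{Post})$ has a finite set of places $P$, a finite set of transitions $T$, and flow functions $\mathrm{Pre},\mathrm{Post}:T\to(P\to\mathbb{N})$. A marking is $m:P\to\mathbb{N}$; $t$ is enabled at $m$ if $m\ge\mathrm{Pre}(t)$, and firing gives $m-\mathrm{Pre}(t)+\mathrm{Post}(t)$. $R(N,m_0)$ is the set of markings reachable from $m_0$ by finite (possibly empty) firing sequences. Linear systems: $E$ is a finite collection of equations $x=y_1+\dots+y_l$, with variable set $\mathrm{fv}(E)$; solutions are non-negative integer; consistent means having a solution. For a partial map $c$ defined exactly on $v_1,\dots,v_k$, $[c]$ is the system $v_1=c(v_1),\dots,v_k=c(v_k)$; commas denote union. $E$-equivalence: $(N_1,m_1)\vartriangleright_E(N_2,m_2)$ (place sets $P_1,P_2$) iff (A1) $E,[m]$ consistent for every $m\in R(N_1,m_1)\cup R(N_2,m_2)$; (A2) $E,[m_1],[m_2]$ consistent; (A3) for all markings $m_1'$ of $N_1$, $m_2'$ of $N_2$ with $E,[m_1'],[m_2']$ consistent, $m_1'\in R(N_1,m_1)\iff m_2'\in R(N_2,m_2)$.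 TFGs: fix pairwise disjoint sets $K(n)$, $n\in\mathbb{N}$, of constant nodes of value $n$, disjoint from place/variable names; $K=\bigcup_nK(n)$. A TFG with places $P$ is $(V,R,A)$, $V=P\cup S$ with $S\subset K$ finite, $R,A\subseteq V\times V$ disjoint; $v\mathbin{\to\!\bullet} w$ iff $(v,w)\in R$, $v\mathbin{\circ\!\to} w$ iff $(v,w)\in A$, $v\to w$ for either. Roots have no incoming arc; $\circ$-leaves have no outgoing $A$-arc. $v\mathbin{\circ\!\to} X$: $X$ is the nonempty set of all $A$-successors of $v$; $X\mathbin{\to\!\bullet} v$: $X$ is the nonempty set of all $R$-predecessors of $v$. Well-formed TFG for $(N_1,m_1)\vartriangleright_E(N_2,m_2)$: (T1) $V\setminus K=P_1\cup P_2\cup\mathrm{fv}(E)$; (T2) nodes in $V\cap K$ are roots; (T3) not both $p\mathbin{\circ\!\to} q$ and $p'\to q$ with $p\ne p'$, and not both $p\mathbin{\to\!\bullet} q$ and $p\mathbin{\circ\!\to} q$; (T4) $v\mathbin{\circ\!\to} X$ or $X\mathbin{\to\!\bullet} v$ iff the equation $v=\sum_{x\in X}x$ is in $E$; (T5) acyclic; (T6) roots not in $K$ are exactly $P_2$, $\circ$-leaves not in $K$ exactly $P_1$. A configuration is a partial $c:V\to\mathbb{N}$ ($\bot$ where undefined) with $c(v)=n$ for $v\in V\cap K(n)$; total if defined everywhere; $c_{|N}$ is its restriction to the places of $N$. For a marking $m$, $c\equiv m$ means $c(p)=m(p)$ for all places $p$ where both are defined. $c$ is well-defined if (CBot) whenever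 $v\to w$, $c(v)=\bot\iff c(w)=\bot$; (CEq) whenever $c(v)\ne\bot$ and ($v\mathbin{\circ\!\to} X$ or $X\mathbin{\to\!\bullet} v$), $c(v)=\sum_{x\in X}c(x)$. -}

module Defs where

open import Data.Nat using (ℕ; zero; suc; _+_; _∸_; _≤_)
open import Data.Fin using (Fin)
open import Data.List using (List; []; _∷_; map)
open import Data.Nat.ListAction using (sum)
open import Data.List.Membership.Propositional using (_∈_)
open import Data.List.Relation.Unary.Unique.Propositional using (Unique)
open import Data.Maybe using (Maybe; just; nothing)
open import Data.Product using (Σ; _×_; _,_; ∃; ∃-syntax)
open import Data.Sum using (_⊎_)
open import Relation.Binary.PropositionalEquality using (_≡_; _≢_)
open import Relation.Nullary using (¬_)
open import Function.Bundles using (_⇔_)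

-- Constant nodes of value n are 'const n i' (i : ℕ an index), so
-- K(n) = { (n , i) | i : ℕ }, pairwise disjoint and disjoint from names.

Const : Set
Const = ℕ × ℕ

Node : Set → Set
Node A = A ⊎ Const

value : Const → ℕ
value (n , _) = n

-- Markings are functions A → ℕ; only
-- their values on the places of the net are meaningful (two markings are
-- the same marking of N when they agree on the places of N).

record Net (A : Set) : Set where
  field
    places : List A
    nT     : ℕ
    pre    : Fin nT → A → ℕ
    post   : Fin nT → A → ℕ
open Net public

Marking : Set → Set
Marking A = A → ℕ

_≈[_]_ : {A : Set} → Marking A → Net A → Marking A → Set
m ≈[ N ] m' = ∀ p → p ∈ places N → m p ≡ m' p

Enabled : {A : Set} (N : Net A) → Fin (nT N) → Marking A → Set
Enabled N t m = ∀ p → p ∈ places N → pre N t p ≤ m p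

Fires : {A : Set} (N : Net A) → Marking A → Fin (nT N) → Marking A → Set
Fires N m t m' = Enabled N t m × (∀ p → p ∈ places N → m' p ≡ (m p ∸ pre N t p) + post N t p)

data Reach {A : Set} (N : Net A) (m0 : Marking A) : Marking A → Set where
  start : ∀ {m} → m ≈[ N ] m0 → Reach N m0 m
  step  : ∀ {m m'} (t : Fin (nT N)) → Reach N m0 m → Fires N m t m' → Reach N m0 m'

record Equation (A : Set) : Set where
  constructor _==_
  field
    lhs : Node A
    rhs : List (Node A)
open Equation public

System : Set → Set
System A = List (Equation A)

FV : {A : Set} → System A → A → Set
FV E a = Σ _ λ e → e ∈ E × (lhs e ≡ _⊎_.inj₁ a ⊎ _⊎_.inj₁ a ∈ rhs e)

eval : {A : Set} → (A → ℕ) → Node A → ℕ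
eval σ (_⊎_.inj₁ a) = σ a
eval σ (_⊎_.inj₂ k) = value k

Solves : {A : Set} → (A → ℕ) → System A → Set
Solves σ E = ∀ e → e ∈ E → eval σ (lhs e) ≡ sum (map (eval σ) (rhs e))

-- σ satisfies [m] for a marking m of N, i.e. the equations p = m(p), p ∈ P
SatMarking : {A : Set} → (A → ℕ) → Net A → Marking A → Set
SatMarking σ N m = ∀ p → p ∈ places N → σ p ≡ m p

Consistent1 : {A : Set} → System A → Net A → Marking A → Set
Consistent1 E N m = ∃[ σ ] (Solves σ E × SatMarking σ N m)

Consistent2 : {A : Set} → System A → Net A → Marking A → Net A → Marking A → Set
Consistent2 E N₁ m₁ N₂ m₂ = ∃[ σ ] (Solves σ E × SatMarking σ N₁ m₁ × SatMarking σ N₂ m₂)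

record EEquiv {A : Set} (N₁ : Net A) (m₁ : Marking A) (E : System A)
              (N₂ : Net A) (m₂ : Marking A) : Set where
  field
    A1 : (∀ m → Reach N₁ m₁ m → Consistent1 E N₁ m)
       × (∀ m → Reach N₂ m₂ m → Consistent1 E N₂ m)
    A2 : Consistent2 E N₁ m₁ N₂ m₂
    A3 : ∀ m₁' m₂' → Consistent2 E N₁ m₁' N₂ m₂' → (Reach N₁ m₁ m₁' ⇔ Reach N₂ m₂ m₂')

-- Token Flow Graphs.  V = names ∪ consts; R = reduction arcs (→•),
-- Ar = agglomeration arcs (∘→).

record TFG (A : Set) : Set where
  field
    names  : List A
    consts : List Const
    Rarcs  : List (Node A × Node A)
    Aarcs  : List (Node A × Node A)
open TFG public

module _ {A : Set} (G : TFG A) where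

  InV : Node A → Set
  InV (_⊎_.inj₁ a) = a ∈ names G
  InV (_⊎_.inj₂ k) = k ∈ consts G

  _→•_ : Node A → Node A → Set
  v →• w = (v , w) ∈ Rarcs G

  _∘→_ : Node A → Node A → Set
  v ∘→ w = (v , w) ∈ Aarcs G

  _⟶_ : Node A → Node A → Set
  v ⟶ w = v →• w ⊎ v ∘→ w

  AggTo : Node A → List (Node A) → Set
  AggTo v X = (X ≢ []) × Unique X × (∀ w → w ∈ X ⇔ v ∘→ w)

  RedFrom : List (Node A) → Node A → Set
  RedFrom X v = (X ≢ []) × Unique X × (∀ w → w ∈ X ⇔ w →• v)

  IsRoot : Node A → Set
  IsRoot v = ∀ w → ¬ (w ⟶ v)

  IsALeaf : Node A → Set
  IsALeaf v = ∀ w → ¬ (v ∘→ w)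

  data Path : Node A → Node A → Set where
    one  : ∀ {v w} → v ⟶ w → Path v w
    more : ∀ {u v w} → u ⟶ v → Path v w → Path u w

  IsTFG : Set
  IsTFG = (∀ v w → v ⟶ w → InV v × InV w)
        × (∀ v w → ¬ (v →• w × v ∘→ w))

  HasEq : System A → Node A → List (Node A) → Set
  HasEq E v X = Σ _ λ e → e ∈ E × lhs e ≡ v
              × (Unique (rhs e) × ∀ w → w ∈ rhs e ⇔ w ∈ X)

  record WellFormed (N₁ : Net A) (E : System A) (N₂ : Net A) : Set where
    field
      tfg : IsTFG
      T1  : ∀ a → a ∈ names G ⇔ (a ∈ places N₁ ⊎ a ∈ places N₂ ⊎ FV E a)
      T2  : ∀ k → k ∈ consts G → IsRoot (_⊎_.inj₂ k)
      T3a : ∀ p p' q → ¬ (p ∘→ q × p' ⟶ q × p ≢ p')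
      T3b : ∀ p q → ¬ (p →• q × p ∘→ q)
      T4a : ∀ v X → (AggTo v X ⊎ RedFrom X v) → HasEq E v X
      T4b : ∀ e → e ∈ E → AggTo (lhs e) (rhs e) ⊎ RedFrom (rhs e) (lhs e)
      T5  : ∀ v → ¬ Path v v
      T6a : ∀ a → (a ∈ names G × IsRoot (_⊎_.inj₁ a)) ⇔ a ∈ places N₂
      T6b : ∀ a → (a ∈ names G × IsALeaf (_⊎_.inj₁ a)) ⇔ a ∈ places N₁

  Config : Set
  Config = Node A → Maybe ℕ

  IsConfig : Config → Set
  IsConfig c = ∀ k → k ∈ consts G → c (_⊎_.inj₂ k) ≡ just (value k)

  Total : Config → Set
  Total c = ∀ v → InV v → Σ ℕ λ n → c v ≡ just n

  sumM : List (Maybe ℕ) → Maybe ℕ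
  sumM [] = just 0
  sumM (nothing ∷ _) = nothing
  sumM (just n ∷ xs) with sumM xs
  ... | just s  = just (n + s)
  ... | nothing = nothing

  WellDefined : Config → Set
  WellDefined c =
      (∀ v w → v ⟶ w → (c v ≡ nothing ⇔ c w ≡ nothing))
    × (∀ v X n → c v ≡ just n → (AggTo v X ⊎ RedFrom X v) → sumM (map c X) ≡ just n)

  Agrees : Config → Net A → Marking A → Set
  Agrees c N m = ∀ p → p ∈ places N → ∀ n → c (_⊎_.inj₁ p) ≡ just n → n ≡ m p

  InInv : Net A → Net A → Marking A → Marking A → Set
  InInv N₁ N₂ m₂' m₁' = Σ Config λ c → IsConfig c × Total c × WellDefined c
                      × Agrees c N₂ m₂'
                      × (∀ p → p ∈ places N₁ → c (_⊎_.inj₁ p) ≡ just (m₁' p))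

-- A family of sets of markings of N, indexed by I-elements satisfying
-- 'Idx', is a partition of the set S (sets of markings of N are
-- predicates respecting ≈[N]; set equality is extensional):
--   * every block is nonempty,
--   * two blocks that intersect are equal,
--   * the union of the blocks is S.

record IsPartition {A I : Set} (Idx : I → Set)
                   (Block : I → Marking A → Set) (S : Marking A → Set) : Set where
  field
    nonempty : ∀ i → Idx i → ∃[ m ] Block i m
    disjoint : ∀ i j → Idx i → Idx j → (∃[ m ] (Block i m × Block j m))
             → ∀ m → Block i m ⇔ Block j m
    covers   : ∀ m → S m ⇔ (∃[ i ] (Idx i × Block i m))

{-# OPTIONS --safe #-}
-- A total well-defined configuration of G is the same thing as a solution of
-- E, so Inv(m₂') is the set of markings m₁' with E, [m₁'], [m₂'] consistent,
-- and (A1)–(A3) yield nonemptiness and covering.  Disjointness holds because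
-- two solutions of E that agree on P₁ agree on every node: a node where they
-- differ is not a ∘-leaf (T6), so by its equation (T4) one of its
-- A-successors differs too; iterating gives ∘-walks longer than the number of
-- A-arcs, which acyclicity (T5) forbids.
module Submission where

open import Defs
open import Data.Fin using (Fin; zero; suc)
import Data.Fin as Fin
open import Data.Fin.Properties using (pigeonhole)
open import Data.List using (List; []; _∷_; map; length; lookup)
open import Data.List.Properties using (map-cong-local)
open import Data.List.Membership.Propositional using (_∈_)
open import Data.List.Membership.Propositional.Properties using (∈-lookup)
open import Data.List.Membership.Propositional.Properties.WithK using (unique∧set⇒bag)
open import Data.List.Relation.Binary.BagAndSetEquality using (∼bag⇒↭)
open import Data.List.Relation.Binary.Permutation.Propositional.Properties using (map⁺)
open import Data.List.Relation.Unary.All as All using (All)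
open import Data.List.Relation.Unary.AllPairs using ([]; _∷_)
open import Data.List.Relation.Unary.Any using (here; there; index)
open import Data.List.Relation.Unary.Any.Properties using (lookup-index)
open import Data.List.Relation.Unary.Unique.Propositional using (Unique)
open import Data.Maybe using (just; fromMaybe)
open import Data.Maybe.Properties using (just-injective)
open import Data.Nat using (ℕ; suc; _≤_; _≤?_; _≟_; s≤s)
open import Data.Nat.ListAction using (sum)
open import Data.Nat.ListAction.Properties using (sum-↭)
open import Data.Nat.Properties using (≰⇒>; <-irrefl)
open import Data.Product using (_×_; _,_; ∃; ∃-syntax; proj₁; proj₂)
open import Data.Sum using (_⊎_; inj₁; inj₂)
open import Effect.Monad using (RawMonad)
open import Function using (_∘_; case_of_)
open import Function.Bundles using (_⇔_; mk⇔; Equivalence)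
open import Relation.Binary.PropositionalEquality
  using (_≡_; _≢_; refl; sym; trans; cong; subst; module ≡-Reasoning)
open import Relation.Nullary using (¬_; Dec; yes; no; contradiction)
open import Relation.Nullary.Decidable using (decidable-stable; ¬¬-excluded-middle)
open import Relation.Nullary.Negation using (DoubleNegation; ¬¬-Monad)
open import Level using (0ℓ)

open Equivalence using (to; from)
open RawMonad (¬¬-Monad {0ℓ}) using (pure; _>>=_)

Unique-lookup-injective : ∀ {B : Set} (xs : List B) → Unique xs →
                          ∀ {i j} → i Fin.< j → lookup xs i ≢ lookup xs j
Unique-lookup-injective (_ ∷ xs) (x∉xs ∷ _)  {zero}  {suc j} _         = All.lookup x∉xs (∈-lookup j)
Unique-lookup-injective (_ ∷ xs) (_ ∷ xs-uniq) {suc i} {suc j} (s≤s i<j) =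
  Unique-lookup-injective xs xs-uniq i<j

Unique-length≤ : ∀ {n} (xs : List (Fin n)) → Unique xs → length xs ≤ n
Unique-length≤ {n} xs xs-uniq = decidable-stable (length xs ≤? n) λ long →
  let i , j , i<j , same = pigeonhole (≰⇒> long) (lookup xs)
  in Unique-lookup-injective xs xs-uniq i<j same

sum-map-sameElements : ∀ {B : Set} (f : B → ℕ) {xs ys : List B} → Unique xs → Unique ys →
                       (∀ w → w ∈ xs ⇔ w ∈ ys) → sum (map f xs) ≡ sum (map f ys)
sum-map-sameElements f xs-uniq ys-uniq xs≈ys =
  sum-↭ (map⁺ f (∼bag⇒↭ (unique∧set⇒bag xs-uniq ys-uniq (λ {w} → xs≈ys w))))

-- Without decidable equality on B the list can only be built under double
-- negation; this suffices because it is only used to refute a discrepancy.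
¬¬-successors : ∀ {B : Set} (L : List (B × B)) (v : B) →
                DoubleNegation (∃[ X ] (Unique X × ∀ w → w ∈ X ⇔ (v , w) ∈ L))
¬¬-successors []            v = pure ([] , [] , λ _ → mk⇔ (λ ()) (λ ()))
¬¬-successors ((a , b) ∷ L) v = do
  X , X-uniq , X≈L ← ¬¬-successors L v
  a≟v ← ¬¬-excluded-middle
  b∈?X ← ¬¬-excluded-middle
  pure (extend X X-uniq X≈L a≟v b∈?X)
  where
  extend : ∀ X → Unique X → (∀ w → w ∈ X ⇔ (v , w) ∈ L) → Dec (a ≡ v) → Dec (b ∈ X) →
           ∃[ Y ] (Unique Y × ∀ w → w ∈ Y ⇔ (v , w) ∈ (a , b) ∷ L)
  extend X X-uniq X≈L (no a≢v) _ = X , X-uniq , λ w → mk⇔ (there ∘ to (X≈L w)) λ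
    { (here eq) → contradiction (sym (cong proj₁ eq)) a≢v
    ; (there vw∈L) → from (X≈L w) vw∈L }
  extend X X-uniq X≈L (yes refl) (yes b∈X) = X , X-uniq , λ w → mk⇔ (there ∘ to (X≈L w)) λ
    { (here eq) → subst (_∈ X) (sym (cong proj₂ eq)) b∈X
    ; (there vw∈L) → from (X≈L w) vw∈L }
  extend X X-uniq X≈L (yes refl) (no b∉X) =
    b ∷ X , All.tabulate (λ w∈X b≡w → b∉X (subst (_∈ X) (sym b≡w) w∈X)) ∷ X-uniq , λ w → mk⇔
      (λ { (here refl) → here refl ; (there w∈X) → there (to (X≈L w) w∈X) })
      (λ { (here eq) → here (cong proj₂ eq) ; (there vw∈L) → there (from (X≈L w) vw∈L) })

module _ {A : Set} (G : TFG A) where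

  data ∘-Walk : ℕ → Node A → Set where
    []  : ∀ {v} → ∘-Walk 0 v
    _∷_ : ∀ {k v w} → _∘→_ G v w → ∘-Walk k w → ∘-Walk (suc k) v

  arcIndices : ∀ {k v} → ∘-Walk k v → List (Fin (length (Aarcs G)))
  arcIndices []         = []
  arcIndices (vw ∷ wlk) = index vw ∷ arcIndices wlk

  length-arcIndices : ∀ {k v} (wlk : ∘-Walk k v) → length (arcIndices wlk) ≡ k
  length-arcIndices []         = refl
  length-arcIndices (_ ∷ wlk) = cong suc (length-arcIndices wlk)

  source : Fin (length (Aarcs G)) → Node A
  source i = proj₁ (lookup (Aarcs G) i)

  source-index : ∀ {v w} (vw : _∘→_ G v w) → source (index vw) ≡ v
  source-index vw = sym (cong proj₁ (lookup-index vw))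

  walk-reaches-source : ∀ {k v i} (wlk : ∘-Walk k v) → i ∈ arcIndices wlk →
                        v ≡ source i ⊎ Path G v (source i)
  walk-reaches-source (vw ∷ wlk) (here refl) = inj₁ (sym (source-index vw))
  walk-reaches-source (vw ∷ wlk) (there i∈) with walk-reaches-source wlk i∈
  ... | inj₁ refl = inj₂ (one (inj₂ vw))
  ... | inj₂ path = inj₂ (more (inj₂ vw) path)

  module _ (acyclic : ∀ v → ¬ Path G v v) where

    arcIndices-unique : ∀ {k v} (wlk : ∘-Walk k v) → Unique (arcIndices wlk)
    arcIndices-unique []                          = []
    arcIndices-unique {v = v} (_∷_ {w = w} vw wlk) =
      All.tabulate first-arc-not-repeated ∷ arcIndices-unique wlk
      where
      first-arc-not-repeated : ∀ {i} → i ∈ arcIndices wlk → index vw ≢ i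
      first-arc-not-repeated i∈ refl =
        acyclic v (close (subst (λ u → w ≡ u ⊎ Path G w u) (source-index vw)
                                (walk-reaches-source wlk i∈)))
        where
        close : w ≡ v ⊎ Path G w v → Path G v v
        close (inj₁ refl) = one (inj₂ vw)
        close (inj₂ path) = more (inj₂ vw) path

    ∘-Walk-length≤ : ∀ {k v} → ∘-Walk k v → k ≤ length (Aarcs G)
    ∘-Walk-length≤ wlk = subst (_≤ length (Aarcs G)) (length-arcIndices wlk)
      (Unique-length≤ (arcIndices wlk) (arcIndices-unique wlk))

solutions-agree-on-equation : ∀ {A : Set} {E : System A} {σ τ : A → ℕ} {e} →
  Solves σ E → Solves τ E → e ∈ E →
  (∀ w → w ∈ rhs e → eval σ w ≡ eval τ w) → eval σ (lhs e) ≡ eval τ (lhs e)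
solutions-agree-on-equation {σ = σ} {τ} {e} σ-sol τ-sol e∈E rhs-agree = begin
  eval σ (lhs e)            ≡⟨ σ-sol e e∈E ⟩
  sum (map (eval σ) (rhs e)) ≡⟨ cong sum (map-cong-local (All.tabulate (rhs-agree _))) ⟩
  sum (map (eval τ) (rhs e)) ≡⟨ τ-sol e e∈E ⟨
  eval τ (lhs e)            ∎
  where open ≡-Reasoning

Consistent2-respʳ : ∀ {A : Set} {E : System A} {N₁ N₂ : Net A} {m i j} → i ≈[ N₂ ] j →
                    Consistent2 E N₁ m N₂ i → Consistent2 E N₁ m N₂ j
Consistent2-respʳ i≈j (σ , σ-sol , σ≈m , σ≈i) =
  σ , σ-sol , σ≈m , λ p p∈P₂ → trans (σ≈i p p∈P₂) (i≈j p p∈P₂)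

module _ {A : Set} {G : TFG A} {N₁ N₂ : Net A} {E : System A}
         (wf : WellFormed G N₁ E N₂) where

  open WellFormed wf

  Flow : Node A → List (Node A) → Set
  Flow v X = AggTo G v X ⊎ RedFrom G X v

  flow-nonempty : ∀ {v X} → Flow v X → X ≢ []
  flow-nonempty (inj₁ (X≢[] , _)) = X≢[]
  flow-nonempty (inj₂ (X≢[] , _)) = X≢[]

  flow-unique : ∀ {v X} → Flow v X → Unique X
  flow-unique (inj₁ (_ , X-uniq , _)) = X-uniq
  flow-unique (inj₂ (_ , X-uniq , _)) = X-uniq

  flow-nodes∈V : ∀ {v X w} → Flow v X → w ∈ X → InV G v × InV G w
  flow-nodes∈V {v} {w = w} (inj₁ (_ , _ , X≈)) w∈X = proj₁ tfg v w (inj₂ (to (X≈ w) w∈X))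
  flow-nodes∈V {v} {w = w} (inj₂ (_ , _ , X≈)) w∈X =
    let w∈V , v∈V = proj₁ tfg w v (inj₁ (to (X≈ w) w∈X)) in v∈V , w∈V

  flow-source∈V : ∀ {v X} → Flow v X → InV G v
  flow-source∈V {X = []}    flow = contradiction refl (flow-nonempty flow)
  flow-source∈V {X = _ ∷ _} flow = proj₁ (flow-nodes∈V flow (here refl))

  P₂⊆V : ∀ {p} → p ∈ places N₂ → InV G (inj₁ p)
  P₂⊆V {p} p∈P₂ = from (T1 p) (inj₂ (inj₁ p∈P₂))

  module _ {σ τ : A → ℕ} (σ-sol : Solves σ E) (τ-sol : Solves τ E)
           (σ≈τ : ∀ p → p ∈ places N₁ → σ p ≡ τ p) where

    Discrepant : Node A → Set
    Discrepant v = InV G v × eval σ v ≢ eval τ v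

    ∘-leaf-agree : ∀ v → InV G v → IsALeaf G v → eval σ v ≡ eval τ v
    ∘-leaf-agree (inj₁ a) a∈V leaf = σ≈τ a (to (T6b a) (a∈V , leaf))
    ∘-leaf-agree (inj₂ k) _   _    = refl

    agree-above-∘-arc : ∀ {v w₀} → _∘→_ G v w₀ → (∀ w → _∘→_ G v w → eval σ w ≡ eval τ w) →
                        DoubleNegation (eval σ v ≡ eval τ v)
    agree-above-∘-arc {v} {w₀} vw₀ successors-agree = do
      X , X-uniq , X≈succ ← ¬¬-successors (Aarcs G) v
      let X≢[] : X ≢ []
          X≢[] = λ { refl → case from (X≈succ w₀) vw₀ of λ () }
          e , e∈E , lhs≡v , _ , rhs≈X = T4a v X (inj₁ (X≢[] , X-uniq , X≈succ))
      pure (subst (λ u → eval σ u ≡ eval τ u) lhs≡v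
        (solutions-agree-on-equation σ-sol τ-sol e∈E λ w w∈rhs →
          successors-agree w (to (X≈succ w) (to (rhs≈X w) w∈rhs))))

    discrepancy-propagates : ∀ {v} → Discrepant v →
                             DoubleNegation (∃[ w ] (_∘→_ G v w × Discrepant w))
    discrepancy-propagates {v} (v∈V , σv≢τv) no-discrepant-successor =
      ¬¬-excluded-middle λ where
        (no no-arc)       → σv≢τv (∘-leaf-agree v v∈V (λ w vw → no-arc (w , vw)))
        (yes (_ , vw₀)) → agree-above-∘-arc vw₀ successors-agree σv≢τv
      where
      successors-agree : ∀ w → _∘→_ G v w → eval σ w ≡ eval τ w
      successors-agree w vw = decidable-stable (eval σ w ≟ eval τ w) λ σw≢τw →
        no-discrepant-successor (w , vw , proj₂ (proj₁ tfg v w (inj₂ vw)) , σw≢τw)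

    discrepant-walk : ∀ k {v} → Discrepant v → DoubleNegation (∘-Walk G k v)
    discrepant-walk 0       _     = pure []
    discrepant-walk (suc k) v-bad = do
      w , vw , w-bad ← discrepancy-propagates v-bad
      wlk ← discrepant-walk k w-bad
      pure (vw ∷ wlk)

    solutions-agree : ∀ v → InV G v → eval σ v ≡ eval τ v
    solutions-agree v v∈V = decidable-stable (eval σ v ≟ eval τ v) λ σv≢τv →
      discrepant-walk (suc (length (Aarcs G))) (v∈V , σv≢τv) λ wlk →
        <-irrefl refl (∘-Walk-length≤ G T5 wlk)

  Consistent2-functional : ∀ {m i j} → Consistent2 E N₁ m N₂ i → Consistent2 E N₁ m N₂ j →
                           i ≈[ N₂ ] j
  Consistent2-functional {i = i} {j} (σ , σ-sol , σ≈m , σ≈i) (τ , τ-sol , τ≈m , τ≈j) p p∈P₂ =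
    begin
      i p ≡⟨ σ≈i p p∈P₂ ⟨
      σ p ≡⟨ solutions-agree σ-sol τ-sol σ≈τ (inj₁ p) (P₂⊆V p∈P₂) ⟩
      τ p ≡⟨ τ≈j p p∈P₂ ⟩
      j p ∎
    where
    open ≡-Reasoning
    σ≈τ : ∀ q → q ∈ places N₁ → σ q ≡ τ q
    σ≈τ q q∈P₁ = trans (σ≈m q q∈P₁) (sym (τ≈m q q∈P₁))

  sumM-just : ∀ (f : Node A → ℕ) xs → sumM G (map (just ∘ f) xs) ≡ just (sum (map f xs))
  sumM-just f []       = refl
  sumM-just f (x ∷ xs) rewrite sumM-just f xs = refl

  config : (A → ℕ) → Config G
  config σ = just ∘ eval σ

  config-wellDefined : ∀ {σ} → Solves σ E → WellDefined G (config σ)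
  config-wellDefined {σ} σ-sol = (λ _ _ _ → mk⇔ (λ ()) (λ ())) , flow-sum
    where
    flow-sum : ∀ v X n → config σ v ≡ just n → Flow v X → sumM G (map (config σ) X) ≡ just n
    flow-sum v X n σv≡n flow with T4a v X flow
    ... | e , e∈E , refl , rhs-uniq , rhs≈X = begin
      sumM G (map (config σ) X)    ≡⟨ sumM-just (eval σ) X ⟩
      just (sum (map (eval σ) X))    ≡⟨ cong just (sum-map-sameElements (eval σ)
                                          (flow-unique flow) rhs-uniq (λ w → mk⇔ (from (rhs≈X w)) (to (rhs≈X w)))) ⟩
      just (sum (map (eval σ) (rhs e))) ≡⟨ cong just (σ-sol e e∈E) ⟨
      just (eval σ (lhs e))          ≡⟨ σv≡n ⟩
      just n                         ∎
      where open ≡-Reasoning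

  assignment : Config G → A → ℕ
  assignment c a = fromMaybe 0 (c (inj₁ a))

  module _ {c : Config G} (c-config : IsConfig G c) (c-total : Total G c)
           (c-wd : WellDefined G c) where

    config-assignment : ∀ v → InV G v → c v ≡ config (assignment c) v
    config-assignment (inj₁ a) a∈V with c (inj₁ a) | c-total (inj₁ a) a∈V
    ... | _ | _ , refl = refl
    config-assignment (inj₂ k) k∈V = c-config k k∈V

    assignment-solves : Solves (assignment c) E
    assignment-solves e e∈E = just-injective (begin
      just (eval σ (lhs e))            ≡⟨ proj₂ c-wd (lhs e) (rhs e) _
                                             (config-assignment (lhs e) (flow-source∈V flow)) flow ⟨
      sumM G (map c (rhs e))           ≡⟨ cong (sumM G) (map-cong-local (All.tabulate λ w∈ →
                                             config-assignment _ (proj₂ (flow-nodes∈V flow w∈)))) ⟩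
      sumM G (map (config σ) (rhs e))  ≡⟨ sumM-just (eval σ) (rhs e) ⟩
      just (sum (map (eval σ) (rhs e))) ∎)
      where
      open ≡-Reasoning
      σ = assignment c
      flow = T4b e e∈E

  InInv⇔Consistent2 : ∀ {m₂' m₁'} → InInv G N₁ N₂ m₂' m₁' ⇔ Consistent2 E N₁ m₁' N₂ m₂'
  InInv⇔Consistent2 {m₂'} {m₁'} = mk⇔ solution-of-config config-of-solution
    where
    solution-of-config : InInv G N₁ N₂ m₂' m₁' → Consistent2 E N₁ m₁' N₂ m₂'
    solution-of-config (c , c-config , c-total , c-wd , c≡m₂' , c≈m₁') =
      assignment c , assignment-solves c-config c-total c-wd
      , (λ p p∈P₁ → cong (fromMaybe 0) (c≈m₁' p p∈P₁))
      , (λ p p∈P₂ → c≡m₂' p p∈P₂ _ (config-assignment c-config c-total c-wd (inj₁ p) (P₂⊆V p∈P₂)))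

    config-of-solution : Consistent2 E N₁ m₁' N₂ m₂' → InInv G N₁ N₂ m₂' m₁'
    config-of-solution (σ , σ-sol , σ≈m₁' , σ≈m₂') =
      config σ , (λ _ _ → refl) , (λ v _ → eval σ v , refl) , config-wellDefined σ-sol
      , (λ p p∈P₂ n σp≡n → trans (sym (just-injective σp≡n)) (σ≈m₂' p p∈P₂))
      , (λ p p∈P₁ → cong just (σ≈m₁' p p∈P₁))

  InInv-resp-≈ : ∀ {i j m} → i ≈[ N₂ ] j → InInv G N₁ N₂ i m → InInv G N₁ N₂ j m
  InInv-resp-≈ {m = m} i≈j =
    from InInv⇔Consistent2 ∘ Consistent2-respʳ {E = E} {N₁} {N₂} {m} i≈j ∘ to InInv⇔Consistent2

theorem3 : {A : Set} (N₁ N₂ : Net A) (m₁ m₂ : Marking A) (E : System A) (G : TFG A)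
    → EEquiv N₁ m₁ E N₂ m₂
    → WellFormed G N₁ E N₂
    → IsPartition (Reach N₂ m₂) (InInv G N₁ N₂) (Reach N₁ m₁)
theorem3 N₁ N₂ m₁ m₂ E G equiv wf = record
  { nonempty = λ m₂' m₂'-reach →
      let σ , σ-sol , σ≈m₂' = proj₂ A1 m₂' m₂'-reach
      in σ , from Inv⇔ (σ , σ-sol , (λ _ _ → refl) , σ≈m₂')
  ; disjoint = λ i j _ _ (_ , m∈Inv-i , m∈Inv-j) _ →
      let i≈j = Consistent2-functional wf (to Inv⇔ m∈Inv-i) (to Inv⇔ m∈Inv-j)
      in mk⇔ (InInv-resp-≈ wf i≈j) (InInv-resp-≈ wf λ p p∈P₂ → sym (i≈j p p∈P₂))
  ; covers = λ m → mk⇔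
      (λ m-reach → let σ , σ-sol , σ≈m = proj₁ A1 m m-reach
                       m↔σ = σ , σ-sol , σ≈m , (λ _ _ → refl)
                   in σ , to (A3 m σ m↔σ) m-reach , from Inv⇔ m↔σ)
      (λ (m₂' , m₂'-reach , m∈Inv) → from (A3 m m₂' (to Inv⇔ m∈Inv)) m₂'-reach)
  }
  where
  open EEquiv equiv
  Inv⇔ : ∀ {m₂' m₁'} → InInv G N₁ N₂ m₂' m₁' ⇔ Consistent2 E N₁ m₁' N₂ m₂'
  Inv⇔ = InInv⇔Consistent2 wf
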